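{- If $G$ is a freely solvable graph and $H$ is a freely neighborhood-solvable graph, then $F(G \,\square\, H) \ge F(G)\,F(H)$.
   Context: Peg solitaire on a graph: a configuration assigns to each vertex either a peg or a hole. If $x,y,z$ form a path $xyz$ with pegs at $x$ and $y$ and a hole at $z$, a jump $xyz$ removes the pegs at $x$ and $y$ and places a peg at $z$. A configuration is solvable if some sequence of jumps reduces it to a single peg. A graph $G$ is freely solvable if, for every vertex $v$, the configuration with a hole only at $v$ (pegs everywhere else) is solvable. A graph $G$ is freely neighborhood-solvable if, for every vertex $v$, the configuration with a hole only at $v$ can be reduced to a single peg located in the closed neighborhood $N[v] = N(v)\cup\{v\}$. A terminal state of $G$ is the set of peg locations when no jump is available, reached by some sequence of jumps from a starting configuration with exactly one hole. The fool's solitaire number $F(G)$ is the maximum size of a terminal state of $G$. The cartesian product $G \,\square\, H$ has vertex set $V(G)\times V(H)$, two vertices being adjacent iff they are equal in one coordinate and adjacent in the other. -}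

module Defs where

open import Data.Nat using (ℕ; _*_; _≤_)
open import Data.Bool using (Bool; true; false)
open import Data.Fin using (Fin; remQuot)
open import Data.Fin.Subset using (Subset; inside; outside; ⁅_⁆; ∁; ∣_∣)
open import Data.Vec using (lookup; _[_]≔_)
open import Data.Product using (Σ; ∃; ∃-syntax; _×_; _,_; proj₁; proj₂)
open import Data.Sum using (_⊎_; inj₁; inj₂)
import Data.Fin as Fin
open import Relation.Binary.PropositionalEquality using (_≡_; _≢_)
import Relation.Binary.PropositionalEquality as ≡
open import Relation.Nullary using (¬_; Dec)
open import Relation.Nullary.Decidable using (_×-dec_; _⊎-dec_)
open import Relation.Binary.Construct.Closure.ReflexiveTransitive using (Star)

record Graph : Set₁ where
  field
    n      : ℕ
    Adj    : Fin n → Fin n → Set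
    adj?   : ∀ x y → Dec (Adj x y)
    sym    : ∀ {x y} → Adj x y → Adj y x
    irrefl : ∀ {x} → ¬ Adj x x

open Graph public

Vertex : Graph → Set
Vertex G = Fin (n G)

-- A configuration: inside = peg, outside = hole.
Config : Graph → Set
Config G = Subset (n G)

Jump : (G : Graph) → Config G → Config G → Set
Jump G C C' = ∃[ x ] ∃[ y ] ∃[ z ]
  ( Adj G x y × Adj G y z × x ≢ z
  × lookup C x ≡ inside × lookup C y ≡ inside × lookup C z ≡ outside
  × C' ≡ ((C [ x ]≔ outside) [ y ]≔ outside) [ z ]≔ inside )

Reach : (G : Graph) → Config G → Config G → Set
Reach G = Star (Jump G)

holeAt : (G : Graph) → Vertex G → Config G
holeAt G v = ∁ ⁅ v ⁆

Solvable : (G : Graph) → Config G → Set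
Solvable G C = ∃[ C' ] (Reach G C C' × ∣ C' ∣ ≡ 1)

FreelySolvable : Graph → Set
FreelySolvable G = ∀ v → Solvable G (holeAt G v)

FreelyNeighborhoodSolvable : Graph → Set
FreelyNeighborhoodSolvable G =
  ∀ v → ∃[ w ] ((w ≡ v ⊎ Adj G v w) × Reach G (holeAt G v) ⁅ w ⁆)

Terminal : (G : Graph) → Config G → Set
Terminal G T = (∃[ v ] Reach G (holeAt G v) T) × (¬ (∃[ T' ] Jump G T T'))

IsFoolNumber : Graph → ℕ → Set
IsFoolNumber G k =
  (∃[ T ] (Terminal G T × ∣ T ∣ ≡ k)) × (∀ T → Terminal G T → ∣ T ∣ ≤ k)

module _ (G H : Graph) where
  PAdj : Fin (n G) × Fin (n H) → Fin (n G) × Fin (n H) → Set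
  PAdj (g , h) (g' , h') = (g ≡ g' × Adj H h h') ⊎ (Adj G g g' × h ≡ h')

  PAdj? : ∀ p q → Dec (PAdj p q)
  PAdj? (g , h) (g' , h') = ((g Fin.≟ g') ×-dec adj? H h h') ⊎-dec (adj? G g g' ×-dec (h Fin.≟ h'))

  PAdj-sym : ∀ {p q} → PAdj p q → PAdj q p
  PAdj-sym (inj₁ (e , a)) = inj₁ (≡.sym e , sym H a)
  PAdj-sym (inj₂ (a , e)) = inj₂ (sym G a , ≡.sym e)

  PAdj-irr : ∀ {p} → ¬ PAdj p p
  PAdj-irr (inj₁ (_ , a)) = irrefl H a
  PAdj-irr (inj₂ (a , _)) = irrefl G a

_□_ : Graph → Graph → Graph
G □ H = record
  { n = n G * n H
  ; Adj = λ a b → PAdj G H (remQuot (n H) a) (remQuot (n H) b)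
  ; adj? = λ a b → PAdj? G H (remQuot (n H) a) (remQuot (n H) b)
  ; sym = PAdj-sym G H
  ; irrefl = PAdj-irr G H
  }

module Submission where

-- Let TG and TH be terminal states reached from the holes g₀ and h₀. Suppose g₀ has a
-- neighbour g₁. Pegs exactly on the column of g₀ and the row of h₀ can be solved: two jumps
-- around a square through (g₀,h₀) and (g₁,h₀) empty (g₁,h₀) and one peg of the column of
-- g₀; that column, now an H-board with one hole, shrinks to (g₀,h₀) because H is freely
-- neighbourhood-solvable, and the row of h₀, a G-board with one hole, is solved in G.
-- Played backwards on complements, this solution leads from a single hole to the board
-- whose holes are that column and row. There every other column plays the game ending in
-- TH, and then every row through TH plays the game ending in TG, leaving TG × TH. Terminal
-- states of freely solvable graphs are independent sets, so TG × TH is stuck. If g₀ is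
-- isolated, TG is a single peg, and the copy of TH in the column of g₀ with pegs elsewhere
-- is terminal.

open import Defs
open import Data.Nat using (ℕ; suc; _+_; _*_; _≤_)
open import Data.Nat.Properties using (suc-injective; ≤-reflexive; *-identityˡ; module ≤-Reasoning)
open import Data.Fin.Subset using (Subset; ⁅_⁆; ∣_∣; ⊥)
open import Data.Fin.Subset.Properties using (x∈⁅x⁆; x∈⁅y⁆⇒x≡y; ∣⁅x⁆∣≡1; ∣⊥∣≡0; p⊆q⇒∣p∣≤∣q∣)
open import Data.Vec using ([]; _∷_; lookup; tabulate; map; _++_; _⊛*_)
open import Data.List using (List; []; _∷_; allFin)
open import Data.List.Membership.Propositional using (_∈_)
open import Data.List.Membership.Propositional.Properties using (∈-allFin)
open import Data.List.Relation.Unary.Any using (here; there)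
import Data.Vec as Vec
open import Data.Vec.Properties
  using (lookup∘update; lookup∘update′; lookup-map; lookup∘tabulate; tabulate∘lookup; tabulate-cong;
         []=⇒lookup; lookup⇒[]=; lookup-⊛*; map-id; map-const)
open import Data.Vec.Relation.Binary.Pointwise.Extensional using (ext; Pointwise-≡⇒≡)
open import Data.Bool using (Bool; true; false; not; _∧_; if_then_else_)
open import Data.Bool.Properties using (not-involutive; ∧-comm)
open import Data.Empty using (⊥-elim)
import Data.Fin as Fin
open import Data.Fin using (combine; remQuot)
open import Data.Fin.Properties using (remQuot-combine; combine-remQuot; any?)
open import Data.Product using (∃-syntax; _×_; _,_; proj₁; proj₂; swap; uncurry)
open import Data.Sum using (_⊎_; inj₁; inj₂)
open import Data.Product.Relation.Binary.Pointwise.NonDependent using (×-decidable; ≡×≡⇒≡; ≡⇒≡×≡)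
open import Function using (_∘_)
open import Relation.Binary.Definitions using (DecidableEquality)
open import Relation.Nullary using (¬_; Dec; yes; no; does)
open import Relation.Nullary.Decidable using (dec-true; dec-false; map′)
open import Relation.Binary.PropositionalEquality
  using (_≡_; _≢_; refl; trans; cong; cong₂; subst; subst₂; _≗_; ≢-sym; module ≡-Reasoning)
  renaming (sym to ≡-sym)
open import Relation.Binary.Construct.Closure.ReflexiveTransitive using (Star; ε; _◅_)

record SimpleGraph (V : Set) : Set₁ where
  field
    _≟_      : DecidableEquality V
    _~_      : V → V → Set
    ~-sym    : ∀ {x y} → x ~ y → y ~ x
    ~-irrefl : ∀ {x} → ¬ x ~ x

  ~⇒≢ : ∀ {x y} → x ~ y → x ≢ y
  ~⇒≢ x~y refl = ~-irrefl x~y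

simple : (G : Graph) → SimpleGraph (Vertex G)
simple G = record { _≟_ = Fin._≟_ ; _~_ = Adj G ; ~-sym = sym G ; ~-irrefl = irrefl G }

_□ₚ_ : (G H : Graph) → SimpleGraph (Vertex G × Vertex H)
G □ₚ H = record
  { _≟_ = λ p q → map′ ≡×≡⇒≡ ≡⇒≡×≡ (×-decidable Fin._≟_ Fin._≟_ p q)
  ; _~_ = PAdj G H
  ; ~-sym = PAdj-sym G H
  ; ~-irrefl = PAdj-irr G H
  }

module Solitaire {V : Set} (Γ : SimpleGraph V) where
  open SimpleGraph Γ public

  Board : Set
  Board = V → Bool

  peg : V → Board
  peg p u = does (u ≟ p)

  hole : V → Board
  hole v = not ∘ peg v

  peg-self : ∀ p → peg p p ≡ true
  peg-self p = dec-true (p ≟ p) refl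

  peg-other : ∀ {p u} → u ≢ p → peg p u ≡ false
  peg-other {p} {u} = dec-false (u ≟ p)

  peg⇒≡ : ∀ {p u} → peg p u ≡ true → u ≡ p
  peg⇒≡ {p} {u} h with u ≟ p
  ... | yes u≡p = u≡p
  ... | no _ with () ← h

  hole⇒≡ : ∀ {v u} → hole v u ≡ false → u ≡ v
  hole⇒≡ {v} {u} h with u ≟ v
  ... | yes u≡v = u≡v
  ... | no _ with () ← h

  infixl 6 _[_]≔_
  _[_]≔_ : Board → V → Bool → Board
  (F [ x ]≔ b) u = if does (u ≟ x) then b else F u

  update-at : ∀ F x b → (F [ x ]≔ b) x ≡ b
  update-at F x b rewrite dec-true (x ≟ x) refl = refl

  update-off : ∀ F {x u} b → u ≢ x → (F [ x ]≔ b) u ≡ F u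
  update-off F {x} {u} b u≢x rewrite dec-false (u ≟ x) u≢x = refl

  infix 4 _⟶_ _⟶*_

  record _⟶_ (F F′ : Board) : Set where
    field
      {x y z} : V
      x~y     : x ~ y
      y~z     : y ~ z
      x≢z     : x ≢ z
      x∈F     : F x ≡ true
      y∈F     : F y ≡ true
      z∉F     : F z ≡ false
      z∈F′    : F′ z ≡ true
      y∉F′    : F′ y ≡ false
      x∉F′    : F′ x ≡ false
      elsewhere : ∀ u → u ≢ x → u ≢ y → u ≢ z → F′ u ≡ F u

  open _⟶_

  afterJump : V → V → V → Board → Board
  afterJump x y z F = F [ x ]≔ false [ y ]≔ false [ z ]≔ true

  module AfterJump (x y z : V) (F : Board) where
    private
      F₁ = F [ x ]≔ false
      F₂ = F₁ [ y ]≔ false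

    at-z : afterJump x y z F z ≡ true
    at-z = update-at F₂ z true

    at-y : y ≢ z → afterJump x y z F y ≡ false
    at-y y≢z = trans (update-off F₂ true y≢z) (update-at F₁ y false)

    at-x : x ≢ y → x ≢ z → afterJump x y z F x ≡ false
    at-x x≢y x≢z =
      trans (update-off F₂ true x≢z) (trans (update-off F₁ false x≢y) (update-at F x false))

    off : ∀ {u} → u ≢ x → u ≢ y → u ≢ z → afterJump x y z F u ≡ F u
    off u≢x u≢y u≢z =
      trans (update-off F₂ true u≢z) (trans (update-off F₁ false u≢y) (update-off F false u≢x))

  jump : ∀ {F x y z} → x ~ y → y ~ z → x ≢ z → F x ≡ true → F y ≡ true → F z ≡ false →
         F ⟶ afterJump x y z F
  jump {F} {x} {y} {z} x~y y~z x≢z x∈F y∈F z∉F = record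
    { x~y = x~y ; y~z = y~z ; x≢z = x≢z ; x∈F = x∈F ; y∈F = y∈F ; z∉F = z∉F
    ; z∈F′ = at-z ; y∉F′ = at-y (~⇒≢ y~z) ; x∉F′ = at-x (~⇒≢ x~y) x≢z
    ; elsewhere = λ _ → off
    }
    where open AfterJump x y z F

  ⟶⇒afterJump : ∀ {F F′} (j : F ⟶ F′) → F′ ≗ afterJump (x j) (y j) (z j) F
  ⟶⇒afterJump {F} {F′} j u = by-cases (u ≟ z j) (u ≟ y j) (u ≟ x j)
    where
    open AfterJump (x j) (y j) (z j) F
    by-cases : Dec (u ≡ z j) → Dec (u ≡ y j) → Dec (u ≡ x j) →
               F′ u ≡ afterJump (x j) (y j) (z j) F u
    by-cases (yes refl) _ _ = trans (z∈F′ j) (≡-sym at-z)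
    by-cases (no u≢z) (yes refl) _ = trans (y∉F′ j) (≡-sym (at-y u≢z))
    by-cases (no u≢z) (no u≢y) (yes refl) = trans (x∉F′ j) (≡-sym (at-x u≢y u≢z))
    by-cases (no u≢z) (no u≢y) (no u≢x) =
      trans (elsewhere j u u≢x u≢y u≢z) (≡-sym (off u≢x u≢y u≢z))

  update-cong : ∀ {F F′} x b → F ≗ F′ → F [ x ]≔ b ≗ F′ [ x ]≔ b
  update-cong x b F≗F′ u = cong (if does (u ≟ x) then b else_) (F≗F′ u)

  afterJump-cong : ∀ {F F′} x y z → F ≗ F′ → afterJump x y z F ≗ afterJump x y z F′
  afterJump-cong x y z = update-cong z true ∘ update-cong y false ∘ update-cong x false

  ⟶-resp-≗ : ∀ {F G F′ G′} → F ≗ G → F′ ≗ G′ → F ⟶ F′ → G ⟶ G′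
  ⟶-resp-≗ F≗G F′≗G′ j = record
    { x~y = x~y j ; y~z = y~z j ; x≢z = x≢z j
    ; x∈F = trans (≡-sym (F≗G _)) (x∈F j)
    ; y∈F = trans (≡-sym (F≗G _)) (y∈F j)
    ; z∉F = trans (≡-sym (F≗G _)) (z∉F j)
    ; z∈F′ = trans (≡-sym (F′≗G′ _)) (z∈F′ j)
    ; y∉F′ = trans (≡-sym (F′≗G′ _)) (y∉F′ j)
    ; x∉F′ = trans (≡-sym (F′≗G′ _)) (x∉F′ j)
    ; elsewhere = λ u u≢x u≢y u≢z →
        trans (≡-sym (F′≗G′ u)) (trans (elsewhere j u u≢x u≢y u≢z) (F≗G u))
    }

  ⟶-dual : ∀ {F F′} → F ⟶ F′ → (not ∘ F′) ⟶ (not ∘ F)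
  ⟶-dual j = record
    { x~y = x~y j ; y~z = y~z j ; x≢z = x≢z j
    ; x∈F = cong not (x∉F′ j) ; y∈F = cong not (y∉F′ j) ; z∉F = cong not (z∈F′ j)
    ; z∈F′ = cong not (z∉F j) ; y∉F′ = cong not (y∈F j) ; x∉F′ = cong not (x∈F j)
    ; elsewhere = λ u u≢x u≢y u≢z → cong not (≡-sym (elsewhere j u u≢x u≢y u≢z))
    }

  infixr 5 _◅_ _◅◅_

  -- Reachability up to pointwise equality of boards, as there is no function extensionality.
  data _⟶*_ : Board → Board → Set where
    stop : ∀ {F F′} → F ≗ F′ → F ⟶* F′
    _◅_  : ∀ {F F₁ F′} → F ⟶ F₁ → F₁ ⟶* F′ → F ⟶* F′

  ≗-⟶* : ∀ {F G F′} → F ≗ G → G ⟶* F′ → F ⟶* F′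
  ≗-⟶* F≗G (stop G≗F′) = stop (λ u → trans (F≗G u) (G≗F′ u))
  ≗-⟶* F≗G (j ◅ r) = ⟶-resp-≗ (λ u → ≡-sym (F≗G u)) (λ _ → refl) j ◅ r

  ⟶*-≗ : ∀ {F F′ G′} → F ⟶* F′ → F′ ≗ G′ → F ⟶* G′
  ⟶*-≗ (stop F≗F′) F′≗G′ = stop (λ u → trans (F≗F′ u) (F′≗G′ u))
  ⟶*-≗ (j ◅ r) F′≗G′ = j ◅ ⟶*-≗ r F′≗G′

  _◅◅_ : ∀ {F F₁ F′} → F ⟶* F₁ → F₁ ⟶* F′ → F ⟶* F′
  stop F≗F₁ ◅◅ r = ≗-⟶* F≗F₁ r
  (j ◅ r₁) ◅◅ r = j ◅ (r₁ ◅◅ r)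

  ⟶*-dual : ∀ {F F′} → F ⟶* F′ → (not ∘ F′) ⟶* (not ∘ F)
  ⟶*-dual (stop F≗F′) = stop (λ u → cong not (≡-sym (F≗F′ u)))
  ⟶*-dual (j ◅ r) = ⟶*-dual r ◅◅ (⟶-dual j ◅ stop (λ _ → refl))

  Stuck : Board → Set
  Stuck F = ∀ {F′} → ¬ F ⟶ F′

  Independent : Board → Set
  Independent F = ∀ {x y} → F x ≡ true → F y ≡ true → ¬ x ~ y

  independent⇒stuck : ∀ {F} → Independent F → Stuck F
  independent⇒stuck independent j = independent (x∈F j) (y∈F j) (x~y j)

  EveryHoleSolvable : Set
  EveryHoleSolvable = ∀ v → ∃[ p ] hole v ⟶* peg p

  holes-persist : ∀ {F F′ v} → F ⟶* F′ → F v ≡ false → ∃[ u ] F′ u ≡ false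
  holes-persist {v = v} (stop F≗F′) Fv = v , trans (≡-sym (F≗F′ v)) Fv
  holes-persist (j ◅ r) _ = holes-persist r (x∉F′ j)

  Closed : (V → Set) → Set
  Closed Q = ∀ {a b} → Q a → a ~ b → Q b

  Full : (V → Set) → Board → Set
  Full Q F = ∀ {u} → Q u → F u ≡ true

  -- Emptying a vertex of a full closed set would need the landing hole inside the set.
  ⟶-full : ∀ {Q F F′} → Closed Q → F ⟶ F′ → Full Q F → Full Q F′
  ⟶-full {Q} {F} closed j full {u} Qu with u ≟ z j | u ≟ y j | u ≟ x j
  ... | yes refl | _ | _ = z∈F′ j
  ... | no _ | yes refl | _ with () ← trans (≡-sym (full (closed Qu (y~z j)))) (z∉F j)
  ... | no _ | no _ | yes refl
    with () ← trans (≡-sym (full (closed (closed Qu (x~y j)) (y~z j)))) (z∉F j)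
  ... | no u≢z | no u≢y | no u≢x = trans (elsewhere j u u≢x u≢y u≢z) (full Qu)

  ⟶*-full : ∀ {Q F F′} → Closed Q → F ⟶* F′ → Full Q F → Full Q F′
  ⟶*-full closed (stop F≗F′) full {u} Qu = trans (≡-sym (F≗F′ u)) (full Qu)
  ⟶*-full closed (j ◅ r) full = ⟶*-full closed r (⟶-full closed j full)

  -- If T had two adjacent pegs x, y, the component K of x would consist of pegs of T.
  -- Were the initial hole v in K, the pegs outside K would never move, yet T must have a
  -- hole; were v outside K, K would stay full, so hole v could not be solved.
  reachable-stuck⇒independent : EveryHoleSolvable → ∀ {v T} → hole v ⟶* T → Stuck T →
                                Independent T
  reachable-stuck⇒independent solvable {v} {T} reach stuck {x} {y} x∈T y∈T x~y =
    v∉K-impossible v∈K-impossible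
    where
    K : V → Set
    K u = Star _~_ u x

    K-closed : Closed K
    K-closed Ka a~b = ~-sym a~b ◅ Ka

    ∁K-closed : Closed (¬_ ∘ K)
    ∁K-closed ¬Ka a~b Kb = ¬Ka (a~b ◅ Kb)

    PegWithPegNeighbour : V → Set
    PegWithPegNeighbour a = T a ≡ true × ∃[ b ] (T b ≡ true × a ~ b)

    spread : ∀ {a b} → PegWithPegNeighbour a → a ~ b → PegWithPegNeighbour b
    spread {a} {b} (a∈T , c , c∈T , a~c) a~b with b ≟ c
    ... | yes refl = c∈T , a , a∈T , ~-sym a~b
    ... | no b≢c with T b in Tb
    ...   | true  = refl , a , a∈T , ~-sym a~b
    ...   | false = ⊥-elim (stuck (jump (~-sym a~c) a~b (≢-sym b≢c) c∈T a∈T Tb))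

    K⊆T : ∀ {u} → K u → T u ≡ true
    K⊆T = proj₁ ∘ spread-along
      where
      spread-along : ∀ {u} → Star _~_ u x → PegWithPegNeighbour u
      spread-along ε = x∈T , y , y∈T , x~y
      spread-along (u~w ◅ w⇝x) = spread (spread-along w⇝x) (~-sym u~w)

    v∈K-impossible : ¬ K v
    v∈K-impossible Kv with holes-persist reach (cong not (peg-self v))
    ... | u , u∉T = ¬Ku-impossible Ku-impossible
      where
      ∁K-full : Full (¬_ ∘ K) (hole v)
      ∁K-full {w} ¬Kw = cong not (peg-other (λ w≡v → ¬Kw (subst K (≡-sym w≡v) Kv)))
      Ku-impossible : ¬ K u
      Ku-impossible Ku with () ← trans (≡-sym (K⊆T Ku)) u∉T
      ¬Ku-impossible : ¬ ¬ K u
      ¬Ku-impossible ¬Ku with () ← trans (≡-sym (⟶*-full ∁K-closed reach ∁K-full ¬Ku)) u∉T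

    v∉K-impossible : ¬ ¬ K v
    v∉K-impossible ¬Kv with solvable v
    ... | p , solve = ~⇒≢ x~y (trans (peg⇒≡ (full ε)) (≡-sym (peg⇒≡ (full (~-sym x~y ◅ ε)))))
      where
      K-full : Full K (hole v)
      K-full {w} Kw = cong not (peg-other (λ w≡v → ¬Kv (subst K w≡v Kw)))
      full : Full K (peg p)
      full = ⟶*-full K-closed solve K-full

  hole-stays-or-neighbour : ∀ {v F} → hole v ⟶* F → F ≗ hole v ⊎ ∃[ w ] v ~ w
  hole-stays-or-neighbour (stop v≗F) = inj₁ (λ u → ≡-sym (v≗F u))
  hole-stays-or-neighbour (j ◅ _) = inj₂ (y j , subst (_~ y j) (hole⇒≡ (z∉F j)) (~-sym (y~z j)))

  EveryHoleNeighbourhoodSolvable : Set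
  EveryHoleNeighbourhoodSolvable = ∀ v → ∃[ w ] ((w ≡ v ⊎ v ~ w) × hole v ⟶* peg w)

  neighbourhood-solvable⇒solvable : EveryHoleNeighbourhoodSolvable → EveryHoleSolvable
  neighbourhood-solvable⇒solvable solvable v with solvable v
  ... | w , _ , solve = w , solve

  solution-reversed : ∀ {v w} → hole v ⟶* peg w → hole w ⟶* peg v
  solution-reversed {v} solve = ⟶*-≗ (⟶*-dual solve) (not-involutive ∘ peg v)

  isolated-reachable≗peg : EveryHoleSolvable → ∀ {v F} → ¬ (∃[ w ] v ~ w) → hole v ⟶* F →
                           ∃[ p ] F ≗ peg p
  isolated-reachable≗peg solvable {v} isolated reach
    with solvable v | hole-stays-or-neighbour reach
  ... | _ , _ | inj₂ neighbour = ⊥-elim (isolated neighbour)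
  ... | p , solve | inj₁ F≗hole with hole-stays-or-neighbour solve
  ...   | inj₂ neighbour = ⊥-elim (isolated neighbour)
  ...   | inj₁ peg≗hole = p , λ u → trans (F≗hole u) (≡-sym (peg≗hole u))

  -- On a 4-cycle a ~ b ~ d ~ c ~ a with pegs at a, b, c and a hole at d, the jump abd
  -- followed by dca or by cdb removes two of the three pegs.
  module Square {a b c d : V} (a~b : a ~ b) (b~d : b ~ d) (d~c : d ~ c) (c~a : c ~ a)
                (a≢d : a ≢ d) (b≢c : b ≢ c) {F : Board}
                (a∈F : F a ≡ true) (b∈F : F b ≡ true) (c∈F : F c ≡ true) (d∉F : F d ≡ false)
    where
    a≢b = ~⇒≢ a~b
    b≢d = ~⇒≢ b~d
    d≢c = ~⇒≢ d~c
    c≢a = ~⇒≢ c~a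

    F₁ : Board
    F₁ = afterJump a b d F

    jump-abd : F ⟶ F₁
    jump-abd = jump a~b b~d a≢d a∈F b∈F d∉F

    c∈F₁ : F₁ c ≡ true
    c∈F₁ = trans (elsewhere jump-abd c c≢a (≢-sym b≢c) (≢-sym d≢c)) c∈F

    jump-dca : F₁ ⟶ afterJump d c a F₁
    jump-dca = jump d~c c~a (≢-sym a≢d) (z∈F′ jump-abd) c∈F₁ (x∉F′ jump-abd)

    jump-cdb : F₁ ⟶ afterJump c d b F₁
    jump-cdb = jump (~-sym d~c) (~-sym b~d) (≢-sym b≢c) c∈F₁ (z∈F′ jump-abd) (y∉F′ jump-abd)

    cleared-first : ∀ {p q} → p ≢ q → (F [ p ]≔ false [ q ]≔ false) p ≡ false
    cleared-first {p} {q} p≢q = trans (update-off (F [ p ]≔ false) false p≢q) (update-at F p false)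

    cleared-second : ∀ {p q} → (F [ p ]≔ false [ q ]≔ false) q ≡ false
    cleared-second {p} {q} = update-at (F [ p ]≔ false) q false

    cleared-off : ∀ {p q u} → u ≢ p → u ≢ q → (F [ p ]≔ false [ q ]≔ false) u ≡ F u
    cleared-off {p} {q} u≢p u≢q =
      trans (update-off (F [ p ]≔ false) false u≢q) (update-off F false u≢p)

    clear-b-c : F ⟶* F [ b ]≔ false [ c ]≔ false
    clear-b-c = jump-abd ◅ jump-dca ◅ stop (λ u → agree u (u ≟ a) (u ≟ c) (u ≟ d) (u ≟ b))
      where
      agree : ∀ u → Dec (u ≡ a) → Dec (u ≡ c) → Dec (u ≡ d) → Dec (u ≡ b) →
              afterJump d c a F₁ u ≡ (F [ b ]≔ false [ c ]≔ false) u
      agree u (yes refl) _ _ _ =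
        trans (z∈F′ jump-dca) (≡-sym (trans (cleared-off a≢b (≢-sym c≢a)) a∈F))
      agree u (no _) (yes refl) _ _ = trans (y∉F′ jump-dca) (≡-sym cleared-second)
      agree u (no _) (no _) (yes refl) _ =
        trans (x∉F′ jump-dca) (≡-sym (trans (cleared-off (≢-sym b≢d) d≢c) d∉F))
      agree u (no u≢a) (no u≢c) (no u≢d) (yes refl) =
        trans (elsewhere jump-dca u u≢d u≢c u≢a) (trans (y∉F′ jump-abd) (≡-sym (cleared-first b≢c)))
      agree u (no u≢a) (no u≢c) (no u≢d) (no u≢b) =
        trans (elsewhere jump-dca u u≢d u≢c u≢a)
          (trans (elsewhere jump-abd u u≢a u≢b u≢d) (≡-sym (cleared-off u≢b u≢c)))

    clear-a-c : F ⟶* F [ a ]≔ false [ c ]≔ false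
    clear-a-c = jump-abd ◅ jump-cdb ◅ stop (λ u → agree u (u ≟ b) (u ≟ c) (u ≟ d) (u ≟ a))
      where
      agree : ∀ u → Dec (u ≡ b) → Dec (u ≡ c) → Dec (u ≡ d) → Dec (u ≡ a) →
              afterJump c d b F₁ u ≡ (F [ a ]≔ false [ c ]≔ false) u
      agree u (yes refl) _ _ _ =
        trans (z∈F′ jump-cdb) (≡-sym (trans (cleared-off (≢-sym a≢b) b≢c) b∈F))
      agree u (no _) (yes refl) _ _ = trans (x∉F′ jump-cdb) (≡-sym cleared-second)
      agree u (no _) (no _) (yes refl) _ =
        trans (y∉F′ jump-cdb) (≡-sym (trans (cleared-off (≢-sym a≢d) d≢c) d∉F))
      agree u (no u≢b) (no u≢c) (no u≢d) (yes refl) =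
        trans (elsewhere jump-cdb u u≢c u≢d u≢b)
          (trans (x∉F′ jump-abd) (≡-sym (cleared-first (≢-sym c≢a))))
      agree u (no u≢b) (no u≢c) (no u≢d) (no u≢a) =
        trans (elsewhere jump-cdb u u≢c u≢d u≢b)
          (trans (elsewhere jump-abd u u≢a u≢b u≢d) (≡-sym (cleared-off u≢a u≢c)))

module Transport {V W : Set} (Γ : SimpleGraph V) (Δ : SimpleGraph W)
  (f : V → W) (g : W → V) (g∘f : ∀ v → g (f v) ≡ v) (f∘g : ∀ w → f (g w) ≡ w)
  (f-hom : ∀ {a b} → SimpleGraph._~_ Γ a b → SimpleGraph._~_ Δ (f a) (f b)) where
  private
    module S = Solitaire Γ
    module T = Solitaire Δ

  f-injective : ∀ {a b} → f a ≡ f b → a ≡ b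
  f-injective {a} {b} fa≡fb = trans (≡-sym (g∘f a)) (trans (cong g fa≡fb) (g∘f b))

  g-avoids : ∀ {u a} → u ≢ f a → g u ≢ a
  g-avoids {u} u≢fa gu≡a = u≢fa (trans (≡-sym (f∘g u)) (cong f gu≡a))

  transport-⟶ : ∀ {F F′} → F S.⟶ F′ → F ∘ g T.⟶ F′ ∘ g
  transport-⟶ {F} {F′} j = record
    { x~y = f-hom x~y ; y~z = f-hom y~z ; x≢z = x≢z ∘ f-injective
    ; x∈F = trans (cong F (g∘f x)) x∈F
    ; y∈F = trans (cong F (g∘f y)) y∈F
    ; z∉F = trans (cong F (g∘f z)) z∉F
    ; z∈F′ = trans (cong F′ (g∘f z)) z∈F′
    ; y∉F′ = trans (cong F′ (g∘f y)) y∉F′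
    ; x∉F′ = trans (cong F′ (g∘f x)) x∉F′
    ; elsewhere = λ u u≢x u≢y u≢z → elsewhere (g u) (g-avoids u≢x) (g-avoids u≢y) (g-avoids u≢z)
    }
    where open S._⟶_ j

  peg-f : ∀ v → T.peg (f v) ≗ S.peg v ∘ g
  peg-f v u with u T.≟ f v | g u S.≟ v
  ... | yes _ | yes _ = refl
  ... | no _ | no _ = refl
  ... | yes refl | no g∘f≢id = ⊥-elim (g∘f≢id (g∘f v))
  ... | no u≢fv | yes refl = ⊥-elim (u≢fv (≡-sym (f∘g u)))

  transport-⟶* : ∀ {F F′} → F S.⟶* F′ → F ∘ g T.⟶* F′ ∘ g
  transport-⟶* (S.stop F≗F′) = T.stop (F≗F′ ∘ g)
  transport-⟶* (j S.◅ r) = transport-⟶ j T.◅ transport-⟶* r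

∣p∣≡0⇒p≡⊥ : ∀ {k} (C : Subset k) → ∣ C ∣ ≡ 0 → C ≡ ⊥
∣p∣≡0⇒p≡⊥ [] _ = refl
∣p∣≡0⇒p≡⊥ (false ∷ C) ∣C∣≡0 = cong (false ∷_) (∣p∣≡0⇒p≡⊥ C ∣C∣≡0)

∣p∣≡1⇒p≡⁅x⁆ : ∀ {k} (C : Subset k) → ∣ C ∣ ≡ 1 → ∃[ p ] C ≡ ⁅ p ⁆
∣p∣≡1⇒p≡⁅x⁆ (true ∷ C) ∣C∣≡1 = Fin.zero , cong (true ∷_) (∣p∣≡0⇒p≡⊥ C (suc-injective ∣C∣≡1))
∣p∣≡1⇒p≡⁅x⁆ (false ∷ C) ∣C∣≡1 with ∣p∣≡1⇒p≡⁅x⁆ C ∣C∣≡1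
... | p , C≡⁅p⁆ = Fin.suc p , cong (false ∷_) C≡⁅p⁆

module OnVectors (G : Graph) where
  open Solitaire (simple G)

  lookup-⁅⁆ : ∀ p → lookup ⁅ p ⁆ ≗ peg p
  lookup-⁅⁆ p u with u ≟ p | lookup ⁅ p ⁆ u in ⁅p⁆[u]
  ... | yes refl | _     = trans (≡-sym ⁅p⁆[u]) ([]=⇒lookup (x∈⁅x⁆ u))
  ... | no _     | false = refl
  ... | no u≢p   | true  = ⊥-elim (u≢p (x∈⁅y⁆⇒x≡y p (lookup⇒[]= u ⁅ p ⁆ ⁅p⁆[u])))

  lookup-holeAt : ∀ v → lookup (holeAt G v) ≗ hole v
  lookup-holeAt v u = trans (lookup-map u not ⁅ v ⁆) (cong not (lookup-⁅⁆ v u))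

  lookup-update : ∀ (C : Config G) x b → lookup (C Vec.[ x ]≔ b) ≗ lookup C [ x ]≔ b
  lookup-update C x b u with u ≟ x
  ... | yes refl = lookup∘update u C b
  ... | no u≢x = lookup∘update′ u≢x C b

  lookup-afterJump : ∀ (C : Config G) x y z →
    lookup (((C Vec.[ x ]≔ false) Vec.[ y ]≔ false) Vec.[ z ]≔ true) ≗ afterJump x y z (lookup C)
  lookup-afterJump C x y z u =
    trans (lookup-update C₂ z true u) (update-cong z true lookup-C₂ u)
    where
    C₁ = C Vec.[ x ]≔ false
    C₂ = C₁ Vec.[ y ]≔ false
    lookup-C₂ : lookup C₂ ≗ lookup C [ x ]≔ false [ y ]≔ false
    lookup-C₂ w =
      trans (lookup-update C₁ y false w) (update-cong y false (lookup-update C x false) w)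

  Jump⇒⟶ : ∀ {C C′} → Jump G C C′ → lookup C ⟶ lookup C′
  Jump⇒⟶ {C} (x , y , z , x~y , y~z , x≢z , x∈C , y∈C , z∉C , refl) =
    ⟶-resp-≗ (λ _ → refl) (≡-sym ∘ lookup-afterJump C x y z) (jump x~y y~z x≢z x∈C y∈C z∉C)

  ⟶⇒Jump : ∀ {F F′} → F ⟶ F′ → Jump G (tabulate F) (tabulate F′)
  ⟶⇒Jump {F} {F′} j =
    x , y , z , x~y , y~z , x≢z ,
    trans (lookup∘tabulate F x) x∈F ,
    trans (lookup∘tabulate F y) y∈F ,
    trans (lookup∘tabulate F z) z∉F ,
    Pointwise-≡⇒≡ (ext λ u → begin
      lookup (tabulate F′) u
        ≡⟨ lookup∘tabulate F′ u ⟩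
      F′ u
        ≡⟨ ⟶⇒afterJump j u ⟩
      afterJump x y z F u
        ≡⟨ afterJump-cong x y z (≡-sym ∘ lookup∘tabulate F) u ⟩
      afterJump x y z (lookup (tabulate F)) u
        ≡⟨ lookup-afterJump (tabulate F) x y z u ⟨
      lookup (((tabulate F Vec.[ x ]≔ false) Vec.[ y ]≔ false) Vec.[ z ]≔ true) u ∎)
    where
    open _⟶_ j
    open ≡-Reasoning

  Reach⇒⟶* : ∀ {C C′} → Reach G C C′ → lookup C ⟶* lookup C′
  Reach⇒⟶* ε = stop (λ _ → refl)
  Reach⇒⟶* (j ◅ r) = Jump⇒⟶ j ◅ Reach⇒⟶* r

  ⟶*⇒Reach : ∀ {F F′} → F ⟶* F′ → Reach G (tabulate F) (tabulate F′)
  ⟶*⇒Reach {F} (stop F≗F′) = subst (Reach G (tabulate F)) (tabulate-cong F≗F′) ε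
  ⟶*⇒Reach (j ◅ r) = ⟶⇒Jump j ◅ ⟶*⇒Reach r

  noJump⇒Stuck : ∀ {T} → ¬ (∃[ T′ ] Jump G T T′) → Stuck (lookup T)
  noJump⇒Stuck {T} noJump j = noJump (_ , subst (λ C → Jump G C _) (tabulate∘lookup T) (⟶⇒Jump j))

  Terminal⇒ : ∀ {T} → Terminal G T → ∃[ v ] (hole v ⟶* lookup T × Stuck (lookup T))
  Terminal⇒ ((v , reach) , noJump) =
    v , ≗-⟶* (≡-sym ∘ lookup-holeAt v) (Reach⇒⟶* reach) , noJump⇒Stuck noJump

  lookup≗peg⇒∣∣≡1 : ∀ {C p} → lookup C ≗ peg p → ∣ C ∣ ≡ 1
  lookup≗peg⇒∣∣≡1 {C} {p} C≗p = trans (cong ∣_∣ C≡⁅p⁆) (∣⁅x⁆∣≡1 p)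
    where
    C≡⁅p⁆ : C ≡ ⁅ p ⁆
    C≡⁅p⁆ = Pointwise-≡⇒≡ (ext λ u → trans (C≗p u) (≡-sym (lookup-⁅⁆ p u)))

  Reach⇒solution : ∀ {v w} → Reach G (holeAt G v) ⁅ w ⁆ → hole v ⟶* peg w
  Reach⇒solution {v} {w} reach =
    ≗-⟶* (≡-sym ∘ lookup-holeAt v) (⟶*-≗ (Reach⇒⟶* reach) (lookup-⁅⁆ w))

  FreelySolvable⇒EveryHoleSolvable : FreelySolvable G → EveryHoleSolvable
  FreelySolvable⇒EveryHoleSolvable solvable v with solvable v
  ... | C , reach , ∣C∣≡1 with ∣p∣≡1⇒p≡⁅x⁆ C ∣C∣≡1
  ...   | p , refl = p , Reach⇒solution reach

  FreelyNeighborhoodSolvable⇒ : FreelyNeighborhoodSolvable G → EveryHoleNeighbourhoodSolvable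
  FreelyNeighborhoodSolvable⇒ solvable v with solvable v
  ... | w , w∈N[v] , reach = w , w∈N[v] , Reach⇒solution reach

module Columns (G H : Graph) where
  open Solitaire (G □ₚ H)
  private
    module ᴴ = Solitaire (simple H)

  column : Vertex G → Board → ᴴ.Board
  column g F h = F (g , h)

  _⟪_≔_⟫ : Board → Vertex G → ᴴ.Board → Board
  (F ⟪ g ≔ Y ⟫) (g′ , h) = if does (g′ Fin.≟ g) then Y h else F (g′ , h)

  column-⟪⟫ : ∀ F g Y → column g (F ⟪ g ≔ Y ⟫) ≗ Y
  column-⟪⟫ F g Y h rewrite dec-true (g Fin.≟ g) refl = refl

  ⟪⟫-off : ∀ F {g g′} Y h → g′ ≢ g → (F ⟪ g ≔ Y ⟫) (g′ , h) ≡ F (g′ , h)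
  ⟪⟫-off F {g} {g′} Y h g′≢g rewrite dec-false (g′ Fin.≟ g) g′≢g = refl

  column-⟶ : ∀ {F g Y Y′} → Y ᴴ.⟶ Y′ → column g F ≗ Y → F ⟶ F ⟪ g ≔ Y′ ⟫
  column-⟶ {F} {g} {Y} {Y′} j F≗Y = record
    { x~y = inj₁ (refl , x~y) ; y~z = inj₁ (refl , y~z) ; x≢z = x≢z ∘ cong proj₂
    ; x∈F = trans (F≗Y x) x∈F ; y∈F = trans (F≗Y y) y∈F ; z∉F = trans (F≗Y z) z∉F
    ; z∈F′ = trans (column-⟪⟫ F g Y′ z) z∈F′
    ; y∉F′ = trans (column-⟪⟫ F g Y′ y) y∉F′
    ; x∉F′ = trans (column-⟪⟫ F g Y′ x) x∉F′
    ; elsewhere = λ (g′ , h) → unchanged g′ h (g′ Fin.≟ g)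
    }
    where
    open ᴴ._⟶_ j
    unchanged : ∀ g′ h → Dec (g′ ≡ g) →
                (g′ , h) ≢ (g , x) → (g′ , h) ≢ (g , y) → (g′ , h) ≢ (g , z) →
                (F ⟪ g ≔ Y′ ⟫) (g′ , h) ≡ F (g′ , h)
    unchanged g′ h (yes refl) ≢x ≢y ≢z =
      trans (column-⟪⟫ F g Y′ h)
        (trans (elsewhere h (≢x ∘ cong (g ,_)) (≢y ∘ cong (g ,_)) (≢z ∘ cong (g ,_)))
          (≡-sym (F≗Y h)))
    unchanged g′ h (no g′≢g) _ _ _ = ⟪⟫-off F Y′ h g′≢g

  column-⟶* : ∀ {F g Y Y′} → Y ᴴ.⟶* Y′ → column g F ≗ Y → F ⟶* F ⟪ g ≔ Y′ ⟫
  column-⟶* {F} {g} {Y} {Y′} (ᴴ.stop Y≗Y′) F≗Y = stop agree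
    where
    agree : F ≗ F ⟪ g ≔ Y′ ⟫
    agree (g′ , h) with g′ Fin.≟ g
    ... | yes refl = trans (F≗Y h) (Y≗Y′ h)
    ... | no _ = refl
  column-⟶* {F} {g} {Y} {Y′} (ᴴ._◅_ {F₁ = Y₁} j r) F≗Y =
    column-⟶ j F≗Y ◅ ⟶*-≗ (column-⟶* r (column-⟪⟫ F g Y₁)) overwrite-twice
    where
    overwrite-twice : F ⟪ g ≔ Y₁ ⟫ ⟪ g ≔ Y′ ⟫ ≗ F ⟪ g ≔ Y′ ⟫
    overwrite-twice (g′ , h) with g′ Fin.≟ g
    ... | yes _ = refl
    ... | no _ = refl

  sweep : ∀ {A B} → (∀ g → column g A ᴴ.⟶* column g B) → A ⟶* B
  sweep {A} {B} steps = ⟶*-≗ (fill-⟶* (allFin (n G))) (λ (g , h) → fill-done (∈-allFin g) h)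
    where
    fill : List (Vertex G) → Board
    fill [] = A
    fill (g ∷ gs) = fill gs ⟪ g ≔ column g B ⟫

    fill-column : ∀ gs g → column g (fill gs) ᴴ.⟶* column g B
    fill-column [] g = steps g
    fill-column (g′ ∷ gs) g with g Fin.≟ g′
    ... | yes refl = ᴴ.stop (λ _ → refl)
    ... | no _ = fill-column gs g

    fill-⟶* : ∀ gs → A ⟶* fill gs
    fill-⟶* [] = stop (λ _ → refl)
    fill-⟶* (g ∷ gs) = fill-⟶* gs ◅◅ column-⟶* (fill-column gs g) (λ _ → refl)

    fill-done : ∀ {g gs} → g ∈ gs → column g (fill gs) ≗ column g B
    fill-done {g} {g′ ∷ gs} g∈ h with g Fin.≟ g′ | g∈
    ... | yes refl | _ = refl
    ... | no g≢g′ | here g≡g′ = ⊥-elim (g≢g′ g≡g′)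
    ... | no _ | there g∈gs = fill-done g∈gs h

  infixr 7 _⊗_
  _⊗_ : (Vertex G → Bool) → ᴴ.Board → Board
  (X ⊗ Y) (g , h) = X g ∧ Y h

  ⊗-⟶*ʳ : ∀ X {Y Y′} → Y ᴴ.⟶* Y′ → X ⊗ Y ⟶* X ⊗ Y′
  ⊗-⟶*ʳ X {Y} {Y′} r = sweep (λ g → on-column (X g))
    where
    on-column : ∀ b → (λ h → b ∧ Y h) ᴴ.⟶* (λ h → b ∧ Y′ h)
    on-column true = r
    on-column false = ᴴ.stop (λ _ → refl)

∣p++q∣≡∣p∣+∣q∣ : ∀ {k l} (p : Subset k) (q : Subset l) → ∣ p ++ q ∣ ≡ ∣ p ∣ + ∣ q ∣
∣p++q∣≡∣p∣+∣q∣ [] q = refl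
∣p++q∣≡∣p∣+∣q∣ (true ∷ p) q = cong suc (∣p++q∣≡∣p∣+∣q∣ p q)
∣p++q∣≡∣p∣+∣q∣ (false ∷ p) q = ∣p++q∣≡∣p∣+∣q∣ p q

∣map∧p⊛*q∣ : ∀ {k l} (p : Subset k) (q : Subset l) → ∣ map _∧_ p ⊛* q ∣ ≡ ∣ p ∣ * ∣ q ∣
∣map∧p⊛*q∣ [] q = refl
∣map∧p⊛*q∣ (true ∷ p) q =
  trans (∣p++q∣≡∣p∣+∣q∣ (map (true ∧_) q) _) (cong₂ _+_ (cong ∣_∣ (map-id q)) (∣map∧p⊛*q∣ p q))
∣map∧p⊛*q∣ {l = l} (false ∷ p) q =
  trans (∣p++q∣≡∣p∣+∣q∣ (map (false ∧_) q) _)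
    (cong₂ _+_ (trans (cong ∣_∣ (map-const q false)) (∣⊥∣≡0 l)) (∣map∧p⊛*q∣ p q))

∧-true : ∀ {a b} → a ∧ b ≡ true → a ≡ true × b ≡ true
∧-true {true} {true} _ = refl , refl
∧-true {true} {false} ()
∧-true {false} ()

module Product (G H : Graph) where
  open Solitaire (G □ₚ H)
  open Columns G H public using (_⊗_; ⊗-⟶*ʳ)
  open Columns G H using (column; sweep)
  private
    module ᴳ = Solitaire (simple G)
    module ᴴ = Solitaire (simple H)
    module Swapped = Columns H G

    swap-~ : ∀ {p q} → PAdj H G p q → PAdj G H (swap p) (swap q)
    swap-~ (inj₁ (h≡h′ , g~g′)) = inj₂ (g~g′ , h≡h′)
    swap-~ (inj₂ (h~h′ , g≡g′)) = inj₁ (g≡g′ , h~h′)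

    open Transport (H □ₚ G) (G □ₚ H) swap swap (λ _ → refl) (λ _ → refl) swap-~

  ⊗-⟶*ˡ : ∀ {X X′} Y → X ᴳ.⟶* X′ → X ⊗ Y ⟶* X′ ⊗ Y
  ⊗-⟶*ˡ {X} {X′} Y r =
    ≗-⟶* (λ (g , h) → ∧-comm (X g) (Y h))
      (⟶*-≗ (transport-⟶* (Swapped.⊗-⟶*ʳ Y r)) (λ (g , h) → ∧-comm (Y h) (X′ g)))

  ⊗-independent : ∀ {X Y} → ᴳ.Independent X → ᴴ.Independent Y → Independent (X ⊗ Y)
  ⊗-independent X-ind Y-ind p∈ q∈ (inj₁ (_ , h~h′)) =
    Y-ind (proj₂ (∧-true p∈)) (proj₂ (∧-true q∈)) h~h′
  ⊗-independent X-ind Y-ind p∈ q∈ (inj₂ (g~g′ , _)) =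
    X-ind (proj₁ (∧-true p∈)) (proj₁ (∧-true q∈)) g~g′

  cross : Vertex G → Vertex H → Board
  cross g₀ h₀ = not ∘ (ᴳ.hole g₀ ⊗ ᴴ.hole h₀)

  module Cross {g₀ g₁ : Vertex G} (g₀~g₁ : Adj G g₀ g₁) (h₀ : Vertex H) where
    private
      g₀≢g₁ = ᴳ.~⇒≢ g₀~g₁

    on-column : ∀ h → cross g₀ h₀ (g₀ , h) ≡ true
    on-column h with g₀ Fin.≟ g₀
    ... | yes _ = refl
    ... | no g₀≢g₀ = ⊥-elim (g₀≢g₀ refl)

    on-row : ∀ g → cross g₀ h₀ (g , h₀) ≡ true
    on-row g with g Fin.≟ g₀ | h₀ Fin.≟ h₀
    ... | yes _ | _ = refl
    ... | no _ | yes _ = refl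
    ... | _ | no h₀≢h₀ = ⊥-elim (h₀≢h₀ refl)

    off-cross : ∀ {g h} → g ≢ g₀ → h ≢ h₀ → cross g₀ h₀ (g , h) ≡ false
    off-cross {g} {h} g≢g₀ h≢h₀ with g Fin.≟ g₀ | h Fin.≟ h₀
    ... | no _ | no _ = refl
    ... | yes g≡g₀ | _ = ⊥-elim (g≢g₀ g≡g₀)
    ... | _ | yes h≡h₀ = ⊥-elim (h≢h₀ h≡h₀)

    cleared : Vertex H → Board
    cleared c = cross g₀ h₀ [ (g₀ , c) ]≔ false [ (g₁ , h₀) ]≔ false

    -- The square a = (g₀,h₀), b = (g₀,w), d = (g₁,w), c = (g₁,h₀) for a neighbour w of h₀.
    cross⟶*cleared : ∀ {w} → Adj H h₀ w → cross g₀ h₀ ⟶* cleared w × cross g₀ h₀ ⟶* cleared h₀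
    cross⟶*cleared {w} h₀~w = clear-b-c , clear-a-c
      where
      open Square (inj₁ (refl , h₀~w)) (inj₂ (g₀~g₁ , refl)) (inj₁ (refl , ᴴ.~-sym h₀~w))
                  (inj₂ (ᴳ.~-sym g₀~g₁ , refl)) (g₀≢g₁ ∘ cong proj₁) (g₀≢g₁ ∘ cong proj₁)
                  (on-column h₀) (on-column w) (on-row g₁)
                  (off-cross (≢-sym g₀≢g₁) (≢-sym (ᴴ.~⇒≢ h₀~w)))

    cleared⟶*row : ∀ {c} → ᴴ.hole c ᴴ.⟶* ᴴ.peg h₀ → cleared c ⟶* ᴳ.hole g₁ ⊗ ᴴ.peg h₀
    cleared⟶*row {c} column-solve = sweep (λ g → by-column g (g Fin.≟ g₀))
      where
      cleared-column₀ : ∀ h → cleared c (g₀ , h) ≡ ᴴ.hole c h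
      cleared-column₀ h with g₀ Fin.≟ g₁ | g₀ Fin.≟ g₀ | h Fin.≟ c
      ... | yes g₀≡g₁ | _ | _ = ⊥-elim (g₀≢g₁ g₀≡g₁)
      ... | no _ | no g₀≢g₀ | _ = ⊥-elim (g₀≢g₀ refl)
      ... | no _ | yes _ | yes _ = refl
      ... | no _ | yes _ | no _ = refl

      row-column₀ : ∀ h → ᴴ.peg h₀ h ≡ (ᴳ.hole g₁ ⊗ ᴴ.peg h₀) (g₀ , h)
      row-column₀ h with g₀ Fin.≟ g₁
      ... | yes g₀≡g₁ = ⊥-elim (g₀≢g₁ g₀≡g₁)
      ... | no _ = refl

      cleared-off-column₀ : ∀ {g} → g ≢ g₀ → ∀ h →
                            cleared c (g , h) ≡ (ᴳ.hole g₁ ⊗ ᴴ.peg h₀) (g , h)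
      cleared-off-column₀ {g} g≢g₀ h with g Fin.≟ g₀ | g Fin.≟ g₁ | h Fin.≟ h₀
      ... | yes g≡g₀ | _ | _ = ⊥-elim (g≢g₀ g≡g₀)
      ... | no _ | yes _ | yes _ = refl
      ... | no _ | yes _ | no _ = refl
      ... | no _ | no _ | yes _ = refl
      ... | no _ | no _ | no _ = refl

      by-column : ∀ g → Dec (g ≡ g₀) → column g (cleared c) ᴴ.⟶* column g (ᴳ.hole g₁ ⊗ ᴴ.peg h₀)
      by-column g (yes refl) = ᴴ.≗-⟶* cleared-column₀ (ᴴ.⟶*-≗ column-solve row-column₀)
      by-column g (no g≢g₀) = ᴴ.stop (cleared-off-column₀ g≢g₀)

    solvable-via : ∀ {c} → ᴳ.EveryHoleSolvable → cross g₀ h₀ ⟶* cleared c →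
                   ᴴ.hole c ᴴ.⟶* ᴴ.peg h₀ → ∃[ q ] cross g₀ h₀ ⟶* peg q
    solvable-via G-solvable start column-solve with G-solvable g₁
    ... | p , row-solve =
      (p , h₀) , start ◅◅ cleared⟶*row column-solve ◅◅ ⊗-⟶*ˡ (ᴴ.peg h₀) row-solve

    cross-solvable : ᴳ.EveryHoleSolvable → ᴴ.EveryHoleNeighbourhoodSolvable →
                     ∃[ q ] cross g₀ h₀ ⟶* peg q
    cross-solvable G-solvable H-solvable with H-solvable h₀
    ... | w , inj₂ h₀~w , solve =
      solvable-via G-solvable (proj₁ (cross⟶*cleared h₀~w)) (ᴴ.solution-reversed solve)
    ... | _ , inj₁ refl , solve with ᴴ.hole-stays-or-neighbour solve
    ...   | inj₁ peg≗hole with () ←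
          trans (≡-sym (ᴴ.peg-self h₀)) (trans (peg≗hole h₀) (cong not (ᴴ.peg-self h₀)))
    ...   | inj₂ (v , h₀~v) = solvable-via G-solvable (proj₂ (cross⟶*cleared h₀~v)) solve

  product-reachable : ∀ {g₀ g₁ h₀ X Y} → ᴳ.EveryHoleSolvable → ᴴ.EveryHoleNeighbourhoodSolvable →
    Adj G g₀ g₁ → ᴳ.hole g₀ ᴳ.⟶* X → ᴴ.hole h₀ ᴴ.⟶* Y → ∃[ q ] hole q ⟶* X ⊗ Y
  product-reachable {g₀} {g₁} {h₀} {X} {Y} G-solvable H-solvable g₀~g₁ X-reach Y-reach
    with Cross.cross-solvable g₀~g₁ h₀ G-solvable H-solvable
  ... | q , solve =
    q , ⟶*-≗ (⟶*-dual solve) (not-involutive ∘ (ᴳ.hole g₀ ⊗ ᴴ.hole h₀))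
        ◅◅ ⊗-⟶*ʳ (ᴳ.hole g₀) Y-reach
        ◅◅ ⊗-⟶*ˡ Y X-reach

  -- Y on the column of g₀, pegs everywhere else.
  column-board : Vertex G → ᴴ.Board → Board
  column-board g₀ Y = not ∘ (ᴳ.peg g₀ ⊗ (not ∘ Y))

  column-reachable : ∀ {g₀ h₀ Y} → ᴴ.hole h₀ ᴴ.⟶* Y → hole (g₀ , h₀) ⟶* column-board g₀ Y
  column-reachable {g₀} {h₀} reach =
    ≗-⟶* (λ (g , h) → cong (λ b → not (ᴳ.peg g₀ g ∧ b)) (≡-sym (not-involutive (ᴴ.peg h₀ h))))
      (⟶*-dual (⊗-⟶*ʳ (ᴳ.peg g₀) (ᴴ.⟶*-dual reach)))

  column-board-hole : ∀ {g₀ Y g h} → column-board g₀ Y (g , h) ≡ false → g ≡ g₀ × Y h ≡ false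
  column-board-hole {g₀} {Y} {g} {h} hole-at with g Fin.≟ g₀ | Y h
  ... | yes g≡g₀ | false = g≡g₀ , refl
  ... | yes _ | true with () ← hole-at
  ... | no _ | _ with () ← hole-at

  column-board-peg : ∀ {g₀ Y h} → column-board g₀ Y (g₀ , h) ≡ true → Y h ≡ true
  column-board-peg {g₀} {Y} {h} peg-at with g₀ Fin.≟ g₀ | Y h
  ... | yes _ | true = refl
  ... | yes _ | false with () ← peg-at
  ... | no g₀≢g₀ | _ = ⊥-elim (g₀≢g₀ refl)

  isolated-column : ∀ {g₀ p h} → ¬ (∃[ g ] Adj G g₀ g) → PAdj G H p (g₀ , h) →
                    proj₁ p ≡ g₀ × Adj H (proj₂ p) h
  isolated-column isolated (inj₁ (g≡g₀ , h~h′)) = g≡g₀ , h~h′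
  isolated-column isolated (inj₂ (g~g₀ , _)) = ⊥-elim (isolated (_ , ᴳ.~-sym g~g₀))

  -- A jump on column-board g₀ Y lands in the column of g₀; as g₀ is isolated, it stays there.
  column-stuck : ∀ {g₀ Y} → ¬ (∃[ g ] Adj G g₀ g) → ᴴ.Stuck Y → Stuck (column-board g₀ Y)
  column-stuck {g₀} {Y} isolated Y-stuck
    record { x = gx , hx ; y = gy , hy ; z = gz , hz ; x~y = x~y ; y~z = y~z ; x≢z = x≢z
           ; x∈F = x∈F ; y∈F = y∈F ; z∉F = z∉F }
    with column-board-hole {g₀} {Y} {gz} z∉F
  ... | refl , hz∉Y with isolated-column {g₀} {gy , hy} isolated y~z
  ...   | refl , hy~hz with isolated-column {g₀} {gx , hx} isolated x~y
  ...     | refl , hx~hy =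
    Y-stuck (ᴴ.jump hx~hy hy~hz (x≢z ∘ cong (g₀ ,_))
               (column-board-peg {g₀} {Y} x∈F) (column-board-peg {g₀} {Y} y∈F) hz∉Y)

  ⊗⊆column-board : ∀ {g₀ Y} p → (ᴳ.peg g₀ ⊗ Y) p ≡ true → column-board g₀ Y p ≡ true
  ⊗⊆column-board {g₀} {Y} (g , h) p∈ with ∧-true {ᴳ.peg g₀ g} p∈
  ... | g₀-column , h∈Y rewrite g₀-column | h∈Y = refl

module Encoding (G H : Graph) where
  open Solitaire (G □ₚ H)
  open Columns G H using (_⊗_)
  open Product G H using (column-board; ⊗⊆column-board)
  private
    module ᴳᴴ = Solitaire (simple (G □ H))
    module V = OnVectors (G □ H)
    module ᴳⱽ = OnVectors G

    combine-~ : ∀ {p q} → PAdj G H p q → Adj (G □ H) (uncurry combine p) (uncurry combine q)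
    combine-~ {g , h} {g′ , h′} =
      subst₂ (PAdj G H) (≡-sym (remQuot-combine g h)) (≡-sym (remQuot-combine g′ h′))

    module Encode = Transport (G □ₚ H) (simple (G □ H)) (uncurry combine) (remQuot {n G} (n H))
                      (uncurry remQuot-combine) (combine-remQuot {n G} (n H)) combine-~
    module Decode = Transport (simple (G □ H)) (G □ₚ H) (remQuot {n G} (n H)) (uncurry combine)
                      (combine-remQuot {n G} (n H)) (uncurry remQuot-combine) (λ a~b → a~b)

  encode : Board → Config (G □ H)
  encode F = tabulate (F ∘ remQuot {n G} (n H))

  encode-terminal : ∀ {q T} → hole q ⟶* T → Stuck T → Terminal (G □ H) (encode T)
  encode-terminal {q} {T} reach stuck =
    (uncurry combine q ,
     subst (λ C → Reach (G □ H) C (encode T)) hole≡ (V.⟶*⇒Reach (Encode.transport-⟶* reach))) ,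
    no-jump
    where
    hole≡ : tabulate (hole q ∘ remQuot {n G} (n H)) ≡ holeAt (G □ H) (uncurry combine q)
    hole≡ = Pointwise-≡⇒≡ (ext λ u →
      trans (lookup∘tabulate _ u)
        (trans (cong not (≡-sym (Encode.peg-f q u))) (≡-sym (V.lookup-holeAt _ u))))
    no-jump : ¬ (∃[ C ] Jump (G □ H) (encode T) C)
    no-jump (_ , j) =
      stuck (⟶-resp-≗ (λ p → cong T (uncurry remQuot-combine p)) (λ _ → refl)
               (Decode.transport-⟶ (ᴳᴴ.⟶-resp-≗ (lookup∘tabulate _) (λ _ → refl) (V.Jump⇒⟶ j))))

  encode-⊗ : ∀ X Y → encode (lookup X ⊗ lookup Y) ≡ (map _∧_ X ⊛* Y)
  encode-⊗ X Y = Pointwise-≡⇒≡ (ext λ u → begin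
    lookup (encode (lookup X ⊗ lookup Y)) u
      ≡⟨ lookup∘tabulate _ u ⟩
    lookup X (g u) ∧ lookup Y (h u)
      ≡⟨ cong (λ f → f (lookup Y (h u))) (lookup-map (g u) _∧_ X) ⟨
    lookup (map _∧_ X) (g u) (lookup Y (h u))
      ≡⟨ lookup-⊛* (map _∧_ X) Y (g u) (h u) ⟨
    lookup (map _∧_ X ⊛* Y) (combine (g u) (h u))
      ≡⟨ cong (lookup (map _∧_ X ⊛* Y)) (combine-remQuot {n G} (n H) u) ⟩
    lookup (map _∧_ X ⊛* Y) u ∎)
    where
    open ≡-Reasoning
    g = proj₁ ∘ remQuot {n G} (n H)
    h = proj₂ ∘ remQuot {n G} (n H)

  ∣encode-⊗∣ : ∀ X Y → ∣ encode (lookup X ⊗ lookup Y) ∣ ≡ ∣ X ∣ * ∣ Y ∣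
  ∣encode-⊗∣ X Y = trans (cong ∣_∣ (encode-⊗ X Y)) (∣map∧p⊛*q∣ X Y)

  encode-mono : ∀ {F F′} → (∀ p → F p ≡ true → F′ p ≡ true) → ∣ encode F ∣ ≤ ∣ encode F′ ∣
  encode-mono {F} {F′} F⊆F′ = p⊆q⇒∣p∣≤∣q∣ {p = encode F} λ {u} u∈ →
    lookup⇒[]= u (encode F′) (trans (lookup∘tabulate (F′ ∘ remQuot {n G} (n H)) u)
      (F⊆F′ _ (trans (≡-sym (lookup∘tabulate (F ∘ remQuot {n G} (n H)) u)) ([]=⇒lookup u∈))))

  ∣encode-column-board∣ : ∀ g₀ Y → ∣ Y ∣ ≤ ∣ encode (column-board g₀ (lookup Y)) ∣
  ∣encode-column-board∣ g₀ Y = begin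
    ∣ Y ∣                                  ≡⟨ *-identityˡ ∣ Y ∣ ⟨
    1 * ∣ Y ∣                              ≡⟨ cong (_* ∣ Y ∣) (∣⁅x⁆∣≡1 g₀) ⟨
    ∣ ⁅ g₀ ⁆ ∣ * ∣ Y ∣                     ≡⟨ ∣encode-⊗∣ ⁅ g₀ ⁆ Y ⟨
    ∣ encode (lookup ⁅ g₀ ⁆ ⊗ lookup Y) ∣  ≤⟨ encode-mono column₀⊆board ⟩
    ∣ encode (column-board g₀ (lookup Y)) ∣ ∎
    where
    open ≤-Reasoning
    column₀⊆board : ∀ p → (lookup ⁅ g₀ ⁆ ⊗ lookup Y) p ≡ true → column-board g₀ (lookup Y) p ≡ true
    column₀⊆board (g , h) p∈ =
      ⊗⊆column-board {Y = lookup Y} (g , h)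
        (subst (λ b → b ∧ lookup Y h ≡ true) (ᴳⱽ.lookup-⁅⁆ g₀ g) p∈)

module FoolProduct (G H : Graph)
  (G-solvable : FreelySolvable G) (H-solvable : FreelyNeighborhoodSolvable H) where
  open Solitaire (G □ₚ H)
  open Product G H
  open Encoding G H
  private
    module ᴳ = Solitaire (simple G)
    module ᴴ = Solitaire (simple H)
    module ᴳⱽ = OnVectors G
    module ᴴⱽ = OnVectors H

    G-every-hole = ᴳⱽ.FreelySolvable⇒EveryHoleSolvable G-solvable
    H-every-hole-near = ᴴⱽ.FreelyNeighborhoodSolvable⇒ H-solvable
    H-every-hole = ᴴ.neighbourhood-solvable⇒solvable H-every-hole-near

  product-terminal : ∀ {g₀ g₁ h₀ X Y} → Adj G g₀ g₁ →
    ᴳ.hole g₀ ᴳ.⟶* X → ᴳ.Stuck X → ᴴ.hole h₀ ᴴ.⟶* Y → ᴴ.Stuck Y → Terminal (G □ H) (encode (X ⊗ Y))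
  product-terminal g₀~g₁ X-reach X-stuck Y-reach Y-stuck =
    encode-terminal (proj₂ (product-reachable G-every-hole H-every-hole-near g₀~g₁ X-reach Y-reach))
      (independent⇒stuck (⊗-independent X-independent Y-independent))
    where
    X-independent = ᴳ.reachable-stuck⇒independent G-every-hole X-reach X-stuck
    Y-independent = ᴴ.reachable-stuck⇒independent H-every-hole Y-reach Y-stuck

  column-terminal : ∀ {g₀ h₀ Y} → ¬ (∃[ g ] Adj G g₀ g) → ᴴ.hole h₀ ᴴ.⟶* Y → ᴴ.Stuck Y →
    Terminal (G □ H) (encode (column-board g₀ Y))
  column-terminal isolated Y-reach Y-stuck =
    encode-terminal (column-reachable Y-reach) (column-stuck isolated Y-stuck)

  terminal-at-least-product : ∀ {TG TH} → Terminal G TG → Terminal H TH →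
    ∃[ T ] (Terminal (G □ H) T × ∣ TG ∣ * ∣ TH ∣ ≤ ∣ T ∣)
  terminal-at-least-product {TG} {TH} G-terminal H-terminal
    with ᴳⱽ.Terminal⇒ G-terminal | ᴴⱽ.Terminal⇒ H-terminal
  ... | g₀ , G-reach , G-stuck | h₀ , H-reach , H-stuck with any? (adj? G g₀)
  ...   | yes (_ , g₀~g₁) =
    _ , product-terminal g₀~g₁ G-reach G-stuck H-reach H-stuck ,
    ≤-reflexive (≡-sym (∣encode-⊗∣ TG TH))
  ...   | no isolated =
    _ , column-terminal isolated H-reach H-stuck , (begin
      ∣ TG ∣ * ∣ TH ∣   ≡⟨ cong (_* ∣ TH ∣) ∣TG∣≡1 ⟩
      1 * ∣ TH ∣        ≡⟨ *-identityˡ ∣ TH ∣ ⟩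
      ∣ TH ∣            ≤⟨ ∣encode-column-board∣ g₀ TH ⟩
      _                 ∎)
    where
    open ≤-Reasoning
    ∣TG∣≡1 : ∣ TG ∣ ≡ 1
    ∣TG∣≡1 =
      ᴳⱽ.lookup≗peg⇒∣∣≡1 {TG} (proj₂ (ᴳ.isolated-reachable≗peg G-every-hole isolated G-reach))

theorem4p1 : (G H : Graph) → FreelySolvable G → FreelyNeighborhoodSolvable H →
    (a b c : ℕ) → IsFoolNumber G a → IsFoolNumber H b → IsFoolNumber (G □ H) c →
    a * b ≤ c
theorem4p1 G H G-solvable H-solvable a b c
  ((TG , G-terminal , ∣TG∣≡a) , _) ((TH , H-terminal , ∣TH∣≡b) , _) (_ , c-maximal)
  with FoolProduct.terminal-at-least-product G H G-solvable H-solvable G-terminal H-terminal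
... | T , T-terminal , ∣TG∣*∣TH∣≤∣T∣ = begin
  a * b             ≡⟨ cong₂ _*_ ∣TG∣≡a ∣TH∣≡b ⟨
  ∣ TG ∣ * ∣ TH ∣   ≤⟨ ∣TG∣*∣TH∣≤∣T∣ ⟩
  ∣ T ∣             ≤⟨ c-maximal T T-terminal ⟩
  c                 ∎
  where open ≤-Reasoning
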